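{- The following two statements are equivalent: (A) for every $n$, every antipodal $2$-colouring of $E(Q_n)$ contains a monochromatic geodesic between some pair of antipodal vertices; (B) for every $n$, in every $2$-colouring of $E(Q_n)$ there is a geodesic between some pair of antipodal vertices which changes colour at most once.
   Context: The hypercube $Q_n$ has vertex set $\{0,1\}^n$, two vertices being adjacent if they differ in exactly one coordinate; the direction of an edge is that coordinate. A path is a geodesic if no two of its edges have the same direction. The antipodal vertex $x'$ of $x$ differs from $x$ in every coordinate; the antipodal edge of $e=xy$ is $x'y'$. A $2$-colouring of $E(Q_n)$ is antipodal if no two antipodal edges receive the same colour. A path changes colour at most once if it is the concatenation of two (possibly empty) monochromatic paths. -}

module Defs where

open import Data.Bool using (Bool; not)
open import Data.Nat using (ℕ)
open import Data.Fin using (Fin)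
open import Data.Vec using (Vec; map; updateAt)
open import Data.List using (List; []; _∷_; _++_)
open import Data.List.Relation.Unary.All using (All)
open import Data.List.Relation.Unary.Unique.Propositional using (Unique)
open import Data.Product using (Σ; ∃; ∃-syntax; _×_; _,_)
open import Relation.Binary.PropositionalEquality using (_≡_; _≢_)

Vertex : ℕ → Set
Vertex n = Vec Bool n

flipAt : ∀ {n} → Vertex n → Fin n → Vertex n
flipAt x i = updateAt x i not

antipode : ∀ {n} → Vertex n → Vertex n
antipode = map not

-- A 2-colouring of E(Q_n): the edge {x, flipAt x i} (direction i) gets colour c x i;
-- well-definedness on edges is the symmetry condition below.
EdgeColouring : ℕ → Set
EdgeColouring n = Vertex n → Fin n → Bool

IsEdgeColouring : ∀ {n} → EdgeColouring n → Set
IsEdgeColouring {n} c = ∀ (x : Vertex n) (i : Fin n) → c x i ≡ c (flipAt x i) i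

-- antipodal edge of {x, flipAt x i} is {antipode x, flipAt (antipode x) i}
IsAntipodal : ∀ {n} → EdgeColouring n → Set
IsAntipodal {n} c = ∀ (x : Vertex n) (i : Fin n) → c x i ≢ c (antipode x) i

-- A path is given by its start vertex and the list of directions of its edges.
endpoint : ∀ {n} → Vertex n → List (Fin n) → Vertex n
endpoint x [] = x
endpoint x (i ∷ is) = endpoint (flipAt x i) is

colours : ∀ {n} → EdgeColouring n → Vertex n → List (Fin n) → List Bool
colours c x [] = []
colours c x (i ∷ is) = c x i ∷ colours c (flipAt x i) is

-- geodesic: no two edges share a direction
IsGeodesic : ∀ {n} → List (Fin n) → Set
IsGeodesic ds = Unique ds

IsAntipodalGeodesic : ∀ {n} → Vertex n → List (Fin n) → Set
IsAntipodalGeodesic x ds = IsGeodesic ds × endpoint x ds ≡ antipode x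

Monochromatic : List Bool → Set
Monochromatic cs = ∃[ b ] All (_≡ b) cs

ChangesColourAtMostOnce : List Bool → Set
ChangesColourAtMostOnce cs =
  ∃[ l₁ ] ∃[ l₂ ] (cs ≡ l₁ ++ l₂ × Monochromatic l₁ × Monochromatic l₂)

StatementA : Set
StatementA = ∀ (n : ℕ) (c : EdgeColouring n) → IsEdgeColouring c → IsAntipodal c →
  ∃[ x ] ∃[ ds ] (IsAntipodalGeodesic x ds × Monochromatic (colours c x ds))

StatementB : Set
StatementB = ∀ (n : ℕ) (c : EdgeColouring n) → IsEdgeColouring c →
  ∃[ x ] ∃[ ds ] (IsAntipodalGeodesic x ds × ChangesColourAtMostOnce (colours c x ds))

-- (B ⇒ A) In an antipodal colouring, take a geodesic from x to x' coloured a up to a vertex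
-- y and b afterwards. If a ≠ b, rotate it: run its second part from y to x', then the
-- antipodal image of its first part from x' to y'. Antipodality recolours that image with
-- not a = b, so the rotated geodesic from y to y' is monochromatic.
--
-- (A ⇒ B) Embed a colouring c of Q_n (n ≥ 1) in an antipodal colouring of Q_{n+1}. A
-- monochromatic antipodal geodesic there crosses between the two copies of Q_n exactly
-- once, at some y; its two halves project to paths of Q_n which, rotated as above, form a
-- geodesic from y' to y changing colour at most once.
module Submission where

open import Defs
open import Function.Bundles using (_⇔_; mk⇔)
open import Data.Bool using (Bool; true; false; not; _≟_)
open import Data.Bool.Properties using (not-involutive; not-¬; ¬-not)
open import Data.Nat using (ℕ; zero; suc)
open import Data.Fin using (Fin; zero; suc)
open import Data.Vec using ([]; _∷_; head)
open import Data.Vec.Properties using (∷-injectiveˡ; ∷-injectiveʳ)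
open import Data.List using (List; []; _∷_; _++_; map)
open import Data.List.Properties using (map-++) renaming (∷-injective to ∷-injective-List)
open import Data.List.Relation.Unary.All as All using (All; []; _∷_)
import Data.List.Relation.Unary.All.Properties as All
open import Data.List.Relation.Unary.Unique.Propositional using (Unique; []; _∷_)
import Data.List.Relation.Unary.Unique.Propositional.Properties as Unique
import Data.List.Relation.Binary.Permutation.Setoid.Properties as Permutation
open import Data.Product using (∃; ∃₂; _×_; _,_; proj₁)
open import Data.Sum using (_⊎_; inj₁; inj₂)
open import Data.Empty using (⊥-elim)
open import Relation.Nullary using (yes; no)
open import Relation.Binary.PropositionalEquality

Unique-++-comm : ∀ {A : Set} (xs ys : List A) → Unique (xs ++ ys) → Unique (ys ++ xs)
Unique-++-comm {A} xs ys = Unique-resp-↭ (++-comm xs ys)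
  where open Permutation (setoid A)

Unique-shift : ∀ {A : Set} (xs : List A) {y ys} →
                 Unique (xs ++ y ∷ ys) → Unique (y ∷ xs ++ ys)
Unique-shift {A} xs {y} {ys} = Unique-resp-↭ (↭-shift xs ys)
  where open Permutation (setoid A)

All≡-map-not⁺ : ∀ {a} {l : List Bool} → All (_≡ a) l → All (_≡ not a) (map not l)
All≡-map-not⁺ h = All.map⁺ (All.map (cong not) h)

All≡-map-not⁻ : ∀ {a} {l : List Bool} → All (_≡ a) (map not l) → All (_≡ not a) l
All≡-map-not⁻ h = All.map (λ {b} e → trans (sym (not-involutive b)) (cong not e)) (All.map⁻ h)

private variable n : ℕ

antipode-involutive : (x : Vertex n) → antipode (antipode x) ≡ x
antipode-involutive []      = refl
antipode-involutive (b ∷ x) = cong₂ _∷_ (not-involutive b) (antipode-involutive x)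

antipode-flipAt : (x : Vertex n) (i : Fin n) → antipode (flipAt x i) ≡ flipAt (antipode x) i
antipode-flipAt (b ∷ x) zero    = refl
antipode-flipAt (b ∷ x) (suc i) = cong (not b ∷_) (antipode-flipAt x i)

endpoint-antipode : (x : Vertex n) (ds : List (Fin n)) →
                    endpoint (antipode x) ds ≡ antipode (endpoint x ds)
endpoint-antipode x []       = refl
endpoint-antipode x (i ∷ ds) = begin
  endpoint (flipAt (antipode x) i) ds ≡⟨ cong (λ v → endpoint v ds) (antipode-flipAt x i) ⟨
  endpoint (antipode (flipAt x i)) ds ≡⟨ endpoint-antipode (flipAt x i) ds ⟩
  antipode (endpoint x (i ∷ ds))      ∎
  where open ≡-Reasoning

endpoint-++ : (x : Vertex n) (p q : List (Fin n)) →
              endpoint x (p ++ q) ≡ endpoint (endpoint x p) q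
endpoint-++ x []      q = refl
endpoint-++ x (i ∷ p) q = endpoint-++ (flipAt x i) p q

module _ (c : EdgeColouring n) where

  colours-++ : (x : Vertex n) (p q : List (Fin n)) →
               colours c x (p ++ q) ≡ colours c x p ++ colours c (endpoint x p) q
  colours-++ x []      q = refl
  colours-++ x (i ∷ p) q = cong (c x i ∷_) (colours-++ (flipAt x i) p q)

  colours-++⁻ : (x : Vertex n) (ds : List (Fin n)) (l₁ : List Bool) {l₂ : List Bool} →
                colours c x ds ≡ l₁ ++ l₂ →
                ∃₂ λ p q → ds ≡ p ++ q × colours c x p ≡ l₁ × colours c (endpoint x p) q ≡ l₂
  colours-++⁻ x ds       []       e = [] , ds , refl , refl , e
  colours-++⁻ x []       (_ ∷ _)  ()
  colours-++⁻ x (i ∷ ds) (_ ∷ l₁) e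
    with refl , e′ ← ∷-injective-List e
    with p , q , refl , refl , e₂ ← colours-++⁻ (flipAt x i) ds l₁ e′
    = i ∷ p , q , refl , refl , e₂

  colours-antipode : IsAntipodal c → (x : Vertex n) (ds : List (Fin n)) →
                     colours c (antipode x) ds ≡ map not (colours c x ds)
  colours-antipode antipodal x []       = refl
  colours-antipode antipodal x (i ∷ ds) =
    cong₂ _∷_ (¬-not (≢-sym (antipodal x i)))
      (trans (cong (λ v → colours c v ds) (sym (antipode-flipAt x i)))
             (colours-antipode antipodal (flipAt x i) ds))

  All≡-colours-antipode : IsAntipodal c → (x : Vertex n) (ds : List (Fin n)) {a : Bool} →
                          All (_≡ a) (colours c x ds) →
                          All (_≡ not a) (colours c (antipode x) ds)
  All≡-colours-antipode antipodal x ds h =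
    subst (All _) (sym (colours-antipode antipodal x ds)) (All≡-map-not⁺ h)

  monochromatic-++ : (x : Vertex n) (p q : List (Fin n)) {a : Bool} →
                     All (_≡ a) (colours c x p) → All (_≡ a) (colours c (endpoint x p) q) →
                     Monochromatic (colours c x (p ++ q))
  monochromatic-++ x p q {a} h₁ h₂ =
    a , subst (All (_≡ a)) (sym (colours-++ x p q)) (All.++⁺ h₁ h₂)

  changesColourAtMostOnce-++ : (x : Vertex n) (p q : List (Fin n)) {a b : Bool} →
                               All (_≡ a) (colours c x p) →
                               All (_≡ b) (colours c (endpoint x p) q) →
                               ChangesColourAtMostOnce (colours c x (p ++ q))
  changesColourAtMostOnce-++ x p q h₁ h₂ = _ , _ , colours-++ x p q , (_ , h₁) , (_ , h₂)

module _ {x : Vertex n} where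

  antipodalGeodesic-antipode : ∀ {ds} → IsAntipodalGeodesic x ds →
                               IsAntipodalGeodesic (antipode x) ds
  antipodalGeodesic-antipode {ds} (u , e) =
    u , trans (endpoint-antipode x ds) (cong antipode e)

  antipodalGeodesic-++ : ∀ p {q} → IsAntipodalGeodesic x (p ++ q) →
                         endpoint (endpoint x p) q ≡ antipode x
  antipodalGeodesic-++ p {q} (_ , e) = trans (sym (endpoint-++ x p q)) e

  antipodalGeodesic-rotate : ∀ p {q} → IsAntipodalGeodesic x (p ++ q) →
                             IsAntipodalGeodesic (endpoint x p) (q ++ p)
  antipodalGeodesic-rotate p {q} geo = Unique-++-comm p q (proj₁ geo) , (begin
    endpoint (endpoint x p) (q ++ p)          ≡⟨ endpoint-++ (endpoint x p) q p ⟩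
    endpoint (endpoint (endpoint x p) q) p    ≡⟨ cong (λ v → endpoint v p) (antipodalGeodesic-++ p geo) ⟩
    endpoint (antipode x) p                   ≡⟨ endpoint-antipode x p ⟩
    antipode (endpoint x p)                   ∎)
    where open ≡-Reasoning

B⇒A : StatementB → StatementA
B⇒A B n c isEdge antipodal
  with x , ds , geo , l₁ , l₂ , eq , (a , mono₁) , (b , mono₂) ← B n c isEdge
  with p , q , refl , refl , refl ← colours-++⁻ c x ds l₁ eq
  with a ≟ b
... | yes refl = x , p ++ q , geo , monochromatic-++ c x p q mono₁ mono₂
... | no a≢b   = endpoint x p , q ++ p , antipodalGeodesic-rotate p geo ,
                 monochromatic-++ c (endpoint x p) q p mono₂ mono₁′
  where
    mono₁′ : All (_≡ b) (colours c (endpoint (endpoint x p) q) p)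
    mono₁′ rewrite antipodalGeodesic-++ p geo | ¬-not (≢-sym a≢b) =
      All≡-colours-antipode c antipodal x p mono₁

HasMonochromaticAntipodalGeodesic : ∀ {n} → EdgeColouring n → Set
HasMonochromaticAntipodalGeodesic c =
  ∃₂ λ x ds → IsAntipodalGeodesic x ds × Monochromatic (colours c x ds)

HasAntipodalGeodesicChangingColourAtMostOnce : ∀ {n} → EdgeColouring n → Set
HasAntipodalGeodesicChangingColourAtMostOnce c =
  ∃₂ λ x ds → IsAntipodalGeodesic x ds × ChangesColourAtMostOnce (colours c x ds)

endpoint-map-suc : ∀ s (x : Vertex n) as → endpoint (s ∷ x) (map suc as) ≡ s ∷ endpoint x as
endpoint-map-suc s x []       = refl
endpoint-map-suc s x (i ∷ as) = endpoint-map-suc s (flipAt x i) as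

endpoint-crossing : ∀ s (x : Vertex n) as bs →
                    endpoint (s ∷ x) (map suc as ++ zero ∷ map suc bs) ≡ not s ∷ endpoint x (as ++ bs)
endpoint-crossing s x as bs = begin
  endpoint (s ∷ x) (map suc as ++ zero ∷ map suc bs)
    ≡⟨ endpoint-++ (s ∷ x) (map suc as) _ ⟩
  endpoint (endpoint (s ∷ x) (map suc as)) (zero ∷ map suc bs)
    ≡⟨ cong (λ v → endpoint v (zero ∷ map suc bs)) (endpoint-map-suc s x as) ⟩
  endpoint (not s ∷ endpoint x as) (map suc bs)
    ≡⟨ endpoint-map-suc (not s) (endpoint x as) bs ⟩
  not s ∷ endpoint (endpoint x as) bs
    ≡⟨ cong (not s ∷_) (endpoint-++ x as bs) ⟨
  not s ∷ endpoint x (as ++ bs)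
    ∎
  where open ≡-Reasoning

splitAtFirstZero : (ds : List (Fin (suc n))) →
                   (∃ λ as → ds ≡ map suc as) ⊎ (∃₂ λ as rest → ds ≡ map suc as ++ zero ∷ rest)
splitAtFirstZero []           = inj₁ ([] , refl)
splitAtFirstZero (zero ∷ ds)  = inj₂ ([] , ds , refl)
splitAtFirstZero (suc i ∷ ds) with splitAtFirstZero ds
... | inj₁ (as , refl)        = inj₁ (i ∷ as , refl)
... | inj₂ (as , rest , refl) = inj₂ (i ∷ as , rest , refl)

All≢zero⇒map-suc : (ds : List (Fin (suc n))) → All (zero ≢_) ds → ∃ λ as → ds ≡ map suc as
All≢zero⇒map-suc []           []             = [] , refl
All≢zero⇒map-suc (zero ∷ ds)  (zero≢zero ∷ _) = ⊥-elim (zero≢zero refl)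
All≢zero⇒map-suc (suc i ∷ ds) (_ ∷ h)
  with as , refl ← All≢zero⇒map-suc ds h = i ∷ as , refl

antipodalGeodesic-suc : ∀ {s} {x : Vertex n} {ds} → IsAntipodalGeodesic (s ∷ x) ds →
                        ∃₂ λ as bs → ds ≡ map suc as ++ zero ∷ map suc bs × IsAntipodalGeodesic x (as ++ bs)
antipodalGeodesic-suc {s = s} {x} {ds} (u , e) with splitAtFirstZero ds
... | inj₁ (as , refl) = ⊥-elim (not-¬ refl (∷-injectiveˡ (trans (sym (endpoint-map-suc s x as)) e)))
... | inj₂ (as , rest , refl)
  with zero∉ ∷ u′ ← Unique-shift (map suc as) u
  with bs , refl ← All≢zero⇒map-suc rest (All.++⁻ʳ (map suc as) zero∉)
  = as , bs , refl ,
    Unique.map⁻ {f = suc} (subst Unique (sym (map-++ suc as bs)) u′) ,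
    ∷-injectiveʳ (trans (sym (endpoint-crossing s x as bs)) e)

-- The copy false ∷ Q_{n+1} is coloured by c and the copy true ∷ Q_{n+1} by x ↦ not (c x').
-- An edge between the copies gets the first coordinate of its Q_{n+1}-part, which the
-- antipode flips; this is where n + 1 ≥ 1 is needed.
antipodalDouble : EdgeColouring (suc n) → EdgeColouring (suc (suc n))
antipodalDouble c (_     ∷ x) zero    = head x
antipodalDouble c (false ∷ x) (suc i) = c x i
antipodalDouble c (true  ∷ x) (suc i) = not (c (antipode x) i)

module _ (c : EdgeColouring (suc n)) where

  antipodalDouble-isEdgeColouring : IsEdgeColouring c → IsEdgeColouring (antipodalDouble c)
  antipodalDouble-isEdgeColouring isEdge (_     ∷ x) zero    = refl
  antipodalDouble-isEdgeColouring isEdge (false ∷ x) (suc i) = isEdge x i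
  antipodalDouble-isEdgeColouring isEdge (true  ∷ x) (suc i) =
    cong not (trans (isEdge (antipode x) i) (cong (λ v → c v i) (sym (antipode-flipAt x i))))

  antipodalDouble-isAntipodal : IsAntipodal (antipodalDouble c)
  antipodalDouble-isAntipodal (_     ∷ b ∷ x) zero    = not-¬ refl
  antipodalDouble-isAntipodal (false ∷ x)     (suc i) =
    not-¬ (cong (λ v → c v i) (sym (antipode-involutive x)))
  antipodalDouble-isAntipodal (true  ∷ x)     (suc i) = ≢-sym (not-¬ refl)

  colours-antipodalDouble-false : (x : Vertex (suc n)) (as : List (Fin (suc n))) →
    colours (antipodalDouble c) (false ∷ x) (map suc as) ≡ colours c x as
  colours-antipodalDouble-false x []       = refl
  colours-antipodalDouble-false x (i ∷ as) =
    cong (c x i ∷_) (colours-antipodalDouble-false (flipAt x i) as)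

  colours-antipodalDouble-true : (x : Vertex (suc n)) (as : List (Fin (suc n))) →
    colours (antipodalDouble c) (true ∷ x) (map suc as) ≡ map not (colours c (antipode x) as)
  colours-antipodalDouble-true x []       = refl
  colours-antipodalDouble-true x (i ∷ as) = cong (not (c (antipode x) i) ∷_) (begin
    colours (antipodalDouble c) (true ∷ flipAt x i) (map suc as)
      ≡⟨ colours-antipodalDouble-true (flipAt x i) as ⟩
    map not (colours c (antipode (flipAt x i)) as)
      ≡⟨ cong (λ v → map not (colours c v as)) (antipode-flipAt x i) ⟩
    map not (colours c (flipAt (antipode x) i) as)
      ∎)
    where open ≡-Reasoning

  colours-antipodalDouble-crossing : (x : Vertex (suc n)) (as bs : List (Fin (suc n))) →
    colours (antipodalDouble c) (false ∷ x) (map suc as ++ zero ∷ map suc bs)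
      ≡ colours c x as ++ head (endpoint x as) ∷ map not (colours c (antipode (endpoint x as)) bs)
  colours-antipodalDouble-crossing x as bs = begin
    colours c⁺ (false ∷ x) (map suc as ++ zero ∷ map suc bs)
      ≡⟨ colours-++ c⁺ (false ∷ x) (map suc as) _ ⟩
    colours c⁺ (false ∷ x) (map suc as) ++ colours c⁺ (endpoint (false ∷ x) (map suc as)) (zero ∷ map suc bs)
      ≡⟨ cong₂ _++_ (colours-antipodalDouble-false x as)
                    (cong (λ v → colours c⁺ v (zero ∷ map suc bs)) (endpoint-map-suc false x as)) ⟩
    colours c x as ++ head y ∷ colours c⁺ (true ∷ y) (map suc bs)
      ≡⟨ cong (λ l → colours c x as ++ head y ∷ l) (colours-antipodalDouble-true y bs) ⟩
    colours c x as ++ head y ∷ map not (colours c (antipode y) bs)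
      ∎
    where
      open ≡-Reasoning
      c⁺ = antipodalDouble c
      y = endpoint x as

  antipodalDouble-monochromatic⇒changesColourAtMostOnce :
    ∀ {x ds} → IsAntipodalGeodesic (false ∷ x) ds →
    Monochromatic (colours (antipodalDouble c) (false ∷ x) ds) →
    HasAntipodalGeodesicChangingColourAtMostOnce c
  antipodalDouble-monochromatic⇒changesColourAtMostOnce {x} geo⁺ (b , mono)
    with as , bs , refl , geo ← antipodalGeodesic-suc geo⁺
    = antipode y , bs ++ as , antipodalGeodesic-antipode (antipodalGeodesic-rotate as geo) ,
      changesColourAtMostOnce-++ c (antipode y) bs as monoBs
        (subst (λ v → All (_≡ b) (colours c v as)) (sym end) monoAs)
    where
      y = endpoint x as
      mono′ : All (_≡ b) (colours c x as ++ head y ∷ map not (colours c (antipode y) bs))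
      mono′ = subst (All (_≡ b)) (colours-antipodalDouble-crossing x as bs) mono
      monoAs : All (_≡ b) (colours c x as)
      monoAs = All.++⁻ˡ (colours c x as) mono′
      monoBs : All (_≡ not b) (colours c (antipode y) bs)
      monoBs = All≡-map-not⁻ (All.tail (All.++⁻ʳ (colours c x as) mono′))
      end : endpoint (antipode y) bs ≡ x
      end = begin
        endpoint (antipode y) bs ≡⟨ endpoint-antipode y bs ⟩
        antipode (endpoint y bs) ≡⟨ cong antipode (antipodalGeodesic-++ as geo) ⟩
        antipode (antipode x)    ≡⟨ antipode-involutive x ⟩
        x                        ∎
        where open ≡-Reasoning

monochromaticAntipodalGeodesic-fromFalse :
  (c : EdgeColouring (suc n)) → IsAntipodal c → HasMonochromaticAntipodalGeodesic c →
  ∃₂ λ x ds → IsAntipodalGeodesic (false ∷ x) ds × Monochromatic (colours c (false ∷ x) ds)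
monochromaticAntipodalGeodesic-fromFalse c _ ((false ∷ x) , ds , geo , mono) = x , ds , geo , mono
monochromaticAntipodalGeodesic-fromFalse c antipodal ((true ∷ x) , ds , geo , (b , mono)) =
  antipode x , ds , antipodalGeodesic-antipode geo ,
  not b , All≡-colours-antipode c antipodal (true ∷ x) ds mono

A⇒B : StatementA → StatementB
A⇒B A zero    c _      = [] , [] , ([] , refl) , [] , [] , refl , (true , []) , (true , [])
A⇒B A (suc n) c isEdge
  with x , ds , geo , mono ← monochromaticAntipodalGeodesic-fromFalse (antipodalDouble c)
         (antipodalDouble-isAntipodal c)
         (A (suc (suc n)) (antipodalDouble c) (antipodalDouble-isEdgeColouring c isEdge)
            (antipodalDouble-isAntipodal c))
  = antipodalDouble-monochromatic⇒changesColourAtMostOnce c geo mono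

proposition1 : StatementA ⇔ StatementB
proposition1 = mk⇔ A⇒B B⇒A
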